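{- Let $F$ be a finite forest with minimum caterpillar partition $\mathcal{P}=\{C_1,\dots,C_\ell\}$, and fix ranks of branch vertices as described in the context. If $F$ contains a component which is not a caterpillar, then there exist distinct $i,j\in[\ell]$ and vertices $x\in C_i$, $y\in C_j$ such that $xy\in E(F)$ and both $x$ and $y$ have rank $1$.
   Context: A caterpillar is a tree $C$ such that, for a maximum path $P$ of $C$, every vertex of $C$ is at distance at most $1$ from $P$. A minimum caterpillar partition of a forest $F$ is a partition $\{C_1,\dots,C_\ell\}$ of the set of non-isolated vertices of $F$ such that (1) each $C_i$ induces a caterpillar in $F$; (2) any edge of $F$ between $C_i$ and $C_j$ ($i\neq j$) is incident to a non-leaf vertex of the induced subgraph on $C_i$ or of the induced subgraph on $C_j$; (3) the number of parts is minimum subject to (1),(2). Edges of $F$ between different parts are branch edges, and their endpoints are branch vertices. Ranks: for each $C_i$ fix a maximum path $L$ of the caterpillar induced on $C_i$, drawn from left to right. The position of the left-most vertex of $L$ is $1$; any other vertex of $L$ has position $1$ plus its distance from the left-most vertex; a vertex not on $L$ has position equal to its distance from the left-most vertex of $L$. List the branch vertices of $C_i$ as $v_{i_1},\dots,v_{i_{b(i)}}$ in nondecreasing order of position (with vertices of equal position in some order); the rank of $v_{i_j}$ is $j$. -}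

module Defs where

open import Data.Nat using (ℕ; zero; suc; _≤_; _≥_)
open import Data.Fin using (Fin)
open import Data.List using (List; []; _∷_; length; last)
open import Data.List.Membership.Propositional using (_∈_; _∉_)
open import Data.List.Relation.Unary.All using (All)
open import Data.List.Relation.Unary.Linked using (Linked)
open import Data.List.Relation.Unary.Unique.Propositional using (Unique)
open import Data.Maybe using (Maybe; just; nothing)
open import Data.Product using (Σ; ∃; ∃-syntax; _×_; _,_)
open import Data.Sum using (_⊎_)
open import Data.Unit using (⊤)
open import Relation.Nullary using (¬_)
open import Relation.Binary using (Decidable)
open import Relation.Binary.PropositionalEquality using (_≡_; _≢_)

record Graph (n : ℕ) : Set₁ where
  field
    E        : Fin n → Fin n → Set
    E-dec    : Decidable E
    E-sym    : ∀ {u v} → E u v → E v u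
    E-irrefl : ∀ {u} → ¬ E u u

VSet : ℕ → Set₁
VSet n = Fin n → Set

module _ {n : ℕ} (G : Graph n) where
  open Graph G

  IsPath : VSet n → List (Fin n) → Set
  IsPath S xs = (length xs ≥ 1) × Unique xs × All S xs × Linked E xs

  IsPathFromTo : VSet n → Fin n → Fin n → List (Fin n) → Set
  IsPathFromTo S a b xs = IsPath S xs × (∃[ rest ] xs ≡ a ∷ rest) × last xs ≡ just b

  IsMaxPath : VSet n → List (Fin n) → Set
  IsMaxPath S P = IsPath S P × (∀ Q → IsPath S Q → length Q ≤ length P)

  Dist : VSet n → Fin n → Fin n → ℕ → Set
  Dist S a b d =
    (∃[ P ] (IsPathFromTo S a b P × length P ≡ suc d)) ×
    (∀ Q → IsPathFromTo S a b Q → suc d ≤ length Q)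

  IsCycle : VSet n → List (Fin n) → Set
  IsCycle S xs = (length xs ≥ 3) × Unique xs × All S xs × Linked E xs ×
                 (∃[ a ] ∃[ b ] ∃[ rest ] (xs ≡ a ∷ rest × last xs ≡ just b × E b a))

  Acyclic : VSet n → Set
  Acyclic S = ¬ (∃[ xs ] IsCycle S xs)

  Connected : VSet n → Set
  Connected S = ∀ a b → S a → S b → ∃[ P ] IsPathFromTo S a b P

  IsTree : VSet n → Set
  IsTree S = (∃[ v ] S v) × Connected S × Acyclic S

  IsCaterpillar : VSet n → Set
  IsCaterpillar S = IsTree S ×
    (∃[ P ] (IsMaxPath S P × (∀ v → S v → v ∈ P ⊎ (∃[ u ] (u ∈ P × E v u)))))

  IsForest : Set
  IsForest = Acyclic (λ _ → ⊤)

  NonIsolated : Fin n → Set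
  NonIsolated v = ∃[ u ] E v u

  IsLeaf : VSet n → Fin n → Set
  IsLeaf S v = ∃[ u ] (S u × E v u × (∀ w → S w → E v w → w ≡ u))

  Component : Fin n → VSet n
  Component v u = ∃[ P ] IsPathFromTo (λ _ → ⊤) v u P

  -- A partition {C_1,...,C_ℓ} of the non-isolated vertices is encoded by
  -- p : Fin n → Maybe (Fin ℓ); C_i = { v | p v ≡ just i }, and
  -- p v ≡ nothing exactly for isolated v.
  Part : {ℓ : ℕ} → (Fin n → Maybe (Fin ℓ)) → Fin ℓ → VSet n
  Part p i v = p v ≡ just i

  IsCatPartition : (ℓ : ℕ) → (Fin n → Maybe (Fin ℓ)) → Set
  IsCatPartition ℓ p =
    (∀ v → NonIsolated v → ∃[ i ] p v ≡ just i) ×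
    (∀ v i → p v ≡ just i → NonIsolated v) ×
    (∀ i → IsCaterpillar (Part p i)) ×
    (∀ u v i j → E u v → p u ≡ just i → p v ≡ just j → i ≢ j →
       ¬ IsLeaf (Part p i) u ⊎ ¬ IsLeaf (Part p j) v)

  IsMinCatPartition : (ℓ : ℕ) → (Fin n → Maybe (Fin ℓ)) → Set
  IsMinCatPartition ℓ p = IsCatPartition ℓ p ×
    (∀ ℓ' (p' : Fin n → Maybe (Fin ℓ')) → IsCatPartition ℓ' p' → ℓ ≤ ℓ')

  IsBranch : {ℓ : ℕ} → (Fin n → Maybe (Fin ℓ)) → Fin ℓ → Fin n → Set
  IsBranch p i v = p v ≡ just i × (∃[ u ] ∃[ j ] (E v u × p u ≡ just j × i ≢ j))

  Position : VSet n → List (Fin n) → Fin n → ℕ → Set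
  Position S L v k = ∃[ a ] ∃[ rest ] (L ≡ a ∷ rest × ∃[ d ] (Dist S a v d ×
                       (v ∈ L → k ≡ suc d) × (v ∉ L → k ≡ d)))

  PosLe : VSet n → List (Fin n) → Fin n → Fin n → Set
  PosLe S L v w = ∀ k m → Position S L v k → Position S L w m → k ≤ m

  -- A ranking of the branch vertices of C_i: a fixed maximum path L of C_i
  -- and an enumeration ord of the branch vertices of C_i (each exactly once)
  -- in nondecreasing order of position; the rank of ord[j] is j+1.
  IsRanking : {ℓ : ℕ} → (Fin n → Maybe (Fin ℓ)) → Fin ℓ →
              List (Fin n) → List (Fin n) → Set
  IsRanking p i L ord = IsMaxPath (Part p i) L × Unique ord ×
    (∀ v → v ∈ ord → IsBranch p i v) × (∀ v → IsBranch p i v → v ∈ ord) ×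
    Linked (PosLe (Part p i) L) ord

  HasRank1 : List (Fin n) → Fin n → Set
  HasRank1 ord x = ∃[ rest ] ord ≡ x ∷ rest

-- Start at the rank-1 vertex x of a part and leave it along a branch edge xy
-- into another part C_j. If y has rank 1 we are done; otherwise walk inside C_j
-- from y to its rank-1 vertex x' and leave C_j along a branch edge at x'. In a
-- forest this never revisits a vertex (a return would close a cycle), so the
-- walk is a path, which cannot grow forever. The walk can only fail to start
-- when the part of a non-isolated vertex has no branch vertex; that part is
-- then a whole component, and a caterpillar. Only the fact that ord i lists
-- the branch vertices of C_i is used: neither minimality of the partition nor
-- the positional order of the ranking plays a role.
module Submission where

open import Defs
open import Data.Nat using (ℕ; _≤_; _<_; _∸_; z≤n; s≤s)
open import Data.Nat.Properties using (≤-trans; n≤1+n; ∸-monoʳ-<)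
open import Data.Nat.Induction using (<-wellFounded)
open import Data.Fin using (Fin; zero; suc; _≟_)
open import Data.Fin.Properties using (any?; injective⇒≤)
open import Data.List using (List; []; _∷_; _++_; length; last; lookup; head)
open import Data.List.Properties using (length-++-≤ʳ)
open import Data.List.Membership.Propositional using (_∈_; _∉_)
open import Data.List.Membership.Propositional.Properties using (∈-lookup; ∉[])
open import Data.List.Relation.Unary.Any using (here; there)
open import Data.List.Relation.Unary.All as All using (All; []; _∷_)
open import Data.List.Relation.Unary.All.Properties using (¬Any⇒All¬)
open import Data.List.Relation.Unary.Linked using (Linked; [-]; _∷_)
open import Data.List.Relation.Unary.Unique.Propositional using (Unique)
open import Data.List.Relation.Unary.AllPairs using ([]; _∷_)
open import Data.Maybe using (Maybe; just)
open import Data.Maybe.Properties using (just-injective)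
open import Data.Product using (∃-syntax; _×_; _,_; proj₁; proj₂)
open import Data.Sum using (_⊎_; inj₁; inj₂)
open import Data.Unit using (tt)
open import Data.Empty using (⊥-elim)
open import Function using (_∘_)
open import Induction.WellFounded using (Acc; acc)
open import Relation.Nullary using (¬_; yes; no)
open import Relation.Unary using (_⊆_; _≐_; ｛_｝)
open import Relation.Binary.PropositionalEquality using (_≡_; _≢_; refl; sym; trans; subst)

lookup-injective : ∀ {a} {A : Set a} {xs : List A} → Unique xs →
                   ∀ {i j} → lookup xs i ≡ lookup xs j → i ≡ j
lookup-injective {xs = _ ∷ _} _ {zero} {zero} _ = refl
lookup-injective {xs = _ ∷ _} (x∉ ∷ _) {zero} {suc j} eq = ⊥-elim (All.lookup x∉ (∈-lookup j) eq)
lookup-injective {xs = _ ∷ _} (x∉ ∷ _) {suc i} {zero} eq = ⊥-elim (All.lookup x∉ (∈-lookup i) (sym eq))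
lookup-injective {xs = _ ∷ _} (_ ∷ u) {suc i} {suc j} eq with lookup-injective u eq
... | refl = refl

Unique⇒length≤ : ∀ {n} {xs : List (Fin n)} → Unique xs → length xs ≤ n
Unique⇒length≤ u = injective⇒≤ (lookup-injective u)

Unique-All-≡⇒length≤1 : ∀ {a} {A : Set a} {v : A} {xs} → All (v ≡_) xs → Unique xs → length xs ≤ 1
Unique-All-≡⇒length≤1 [] _ = z≤n
Unique-All-≡⇒length≤1 (_ ∷ []) _ = s≤s z≤n
Unique-All-≡⇒length≤1 (v≡x ∷ v≡y ∷ _) ((x≢y ∷ _) ∷ _) = ⊥-elim (x≢y (trans (sym v≡x) v≡y))

last∈ : ∀ {a} {A : Set a} {w : A} xs → last xs ≡ just w → w ∈ xs
last∈ (_ ∷ []) refl = here refl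
last∈ (_ ∷ y ∷ xs) eq = there (last∈ (y ∷ xs) eq)

nonempty : ∀ {a} {A : Set a} {v : A} {xs} → v ∈ xs → ∃[ x ] ∃[ rest ] xs ≡ x ∷ rest
nonempty {xs = x ∷ rest} _ = x , rest , refl

unique-extension-terminates :
  ∀ {n p q} {Q : Set q} (P : List (Fin n) → Set p) →
  (∀ {xs} → P xs → Unique xs) →
  (∀ {xs} → P xs → Q ⊎ ∃[ ys ] (P ys × length xs < length ys)) →
  ∀ {xs} → P xs → Q
unique-extension-terminates {n} {Q = Q} P unique step Pxs = go Pxs (<-wellFounded _)
  where
  go : ∀ {xs} → P xs → Acc _<_ (n ∸ length xs) → Q
  go Pxs (acc smaller) with step Pxs
  ... | inj₁ q = q
  ... | inj₂ (ys , Pys , longer) =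
    go Pys (smaller (∸-monoʳ-< longer (Unique⇒length≤ (unique Pys))))

module _ {n : ℕ} (G : Graph n) where
  open Graph G

  SimplePath : List (Fin n) → Set
  SimplePath xs = Unique xs × Linked E xs

  simple-prefix : ∀ {y ys z} → SimplePath (y ∷ ys) → z ∈ y ∷ ys →
                  ∃[ r ] (SimplePath (y ∷ r) × last (y ∷ r) ≡ just z × All (_∈ ys) r)
  simple-prefix _ (here refl) = [] , ([] ∷ [] , [-]) , refl , []
  simple-prefix {ys = y′ ∷ _} (y∉ ∷ u , e ∷ l) (there z∈) with simple-prefix (u , l) z∈
  ... | r , (u′ , l′) , ends , r⊆ = y′ ∷ r , (All.map (All.lookup y∉) ⊆ys ∷ u′ , e ∷ l′) , ends , ⊆ys
    where
    ⊆ys : All (_∈ y′ ∷ _) (y′ ∷ r)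
    ⊆ys = here refl ∷ All.map there r⊆

  IsPath-mono : ∀ {S T : VSet n} → S ⊆ T → IsPath G S ⊆ IsPath G T
  IsPath-mono S⊆T (len , u , inS , l) = len , u , All.map S⊆T inS , l

  caterpillar-connected : ∀ {S} → IsCaterpillar G S → Connected G S
  caterpillar-connected ((_ , connected , _) , _) = connected

  IsCaterpillar-resp : ∀ {S T : VSet n} → S ≐ T → IsCaterpillar G S → IsCaterpillar G T
  IsCaterpillar-resp {S} {T} (S⊆T , T⊆S) (((v , Sv) , connected , acyclic) , P , (path , longest) , near) =
    ((v , S⊆T Sv) , connected′ , acyclic′) ,
    P , (IsPath-mono S⊆T path , λ Q q → longest Q (IsPath-mono T⊆S q)) , λ w Tw → near w (T⊆S Tw)
    where
    connected′ : Connected G T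
    connected′ a b Ta Tb with connected a b (T⊆S Ta) (T⊆S Tb)
    ... | Q , q , starts , ends = Q , IsPath-mono S⊆T q , starts , ends
    acyclic′ : Acyclic G T
    acyclic′ (xs , len , u , inT , rest) = acyclic (xs , len , u , All.map T⊆S inT , rest)

  ｛｝-caterpillar : ∀ v → IsCaterpillar G ｛ v ｝
  ｛｝-caterpillar v =
    ((v , refl) , connected , acyclic) ,
    v ∷ [] , (trivial , λ _ q → short q) , λ _ v≡w → inj₁ (here (sym v≡w))
    where
    trivial : IsPath G ｛ v ｝ (v ∷ [])
    trivial = s≤s z≤n , [] ∷ [] , refl ∷ [] , [-]
    short : ∀ {Q} → IsPath G ｛ v ｝ Q → length Q ≤ 1
    short (_ , u , v≡ , _) = Unique-All-≡⇒length≤1 v≡ u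
    connected : Connected G ｛ v ｝
    connected _ _ refl refl = v ∷ [] , trivial , ([] , refl) , refl
    acyclic : Acyclic G ｛ v ｝
    acyclic (_ , len≥3 , u , v≡ , _) with ≤-trans len≥3 (Unique-All-≡⇒length≤1 v≡ u)
    ... | s≤s ()

  component-of-closed : ∀ {S v} → Connected G S → (∀ {a b} → S a → E a b → S b) → S v →
                        S ≐ Component G v
  component-of-closed {S} {v} connected closed Sv = S⊆C , C⊆S
    where
    S⊆C : S ⊆ Component G v
    S⊆C {w} Sw with connected v w Sv Sw
    ... | P , path , starts , ends = P , IsPath-mono (λ _ → tt) path , starts , ends
    stays : ∀ {a r} → S a → Linked E (a ∷ r) → All S (a ∷ r)
    stays Sa [-] = Sa ∷ []
    stays Sa (e ∷ l) = Sa ∷ stays (closed Sa e) l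
    C⊆S : Component G v ⊆ S
    C⊆S (_ , (_ , _ , _ , l) , (_ , refl) , ends) = All.lookup (stays Sv l) (last∈ _ ends)

  isolated-component-caterpillar : ∀ {v} → ¬ NonIsolated G v → IsCaterpillar G (Component G v)
  isolated-component-caterpillar {v} isolated =
    IsCaterpillar-resp (component-of-closed (caterpillar-connected singleton) stays refl) singleton
    where
    singleton : IsCaterpillar G ｛ v ｝
    singleton = ｛｝-caterpillar v
    stays : ∀ {a b} → v ≡ a → E a b → v ≡ b
    stays refl e = ⊥-elim (isolated (_ , e))

  module _ (forest : IsForest G) where

    no-chord : ∀ {c d rest z} → SimplePath (c ∷ d ∷ rest) → z ∈ rest → ¬ E c z
    no-chord (c∉ ∷ d∉ ∷ u , e ∷ l) z∈ ecz with simple-prefix (d∉ ∷ u , l) (there z∈)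
    ... | [] , _ , ends , _ = All.lookup d∉ z∈ (just-injective ends)
    ... | r ∷ rs , (u′ , l′) , ends , ⊆rest =
      forest (_ ∷ _ ∷ r ∷ rs , s≤s (s≤s (s≤s z≤n)) ,
              All.map (All.lookup c∉) (here refl ∷ All.map there ⊆rest) ∷ u′ ,
              All.universal (λ _ → tt) _ , e ∷ l′ , _ , _ , _ , refl , ends , E-sym ecz)

    ∉-extension : ∀ {c W z} → SimplePath (c ∷ W) → E c z → head W ≢ just z → z ∉ c ∷ W
    ∉-extension _ ecz _ (here refl) = E-irrefl ecz
    ∉-extension _ _ not-next (there (here refl)) = not-next refl
    ∉-extension path ecz _ (there (there z∈)) = no-chord path z∈ ecz

    extend : ∀ {c W z} → SimplePath (c ∷ W) → E c z → head W ≢ just z → SimplePath (z ∷ c ∷ W)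
    extend path@(u , l) ecz not-next =
      ¬Any⇒All¬ _ (∉-extension path ecz not-next) ∷ u , E-sym ecz ∷ l

    extend-along : ∀ {c d W} P → SimplePath (c ∷ d ∷ W) → SimplePath P → last P ≡ just c →
                   d ∉ P → SimplePath (P ++ d ∷ W)
    extend-along (_ ∷ []) walk _ refl _ = walk
    extend-along (_ ∷ b ∷ []) walk (_ ∷ u , e ∷ l) ends d∉ =
      extend (extend-along (b ∷ []) walk (u , l) ends (d∉ ∘ there)) (E-sym e)
             (d∉ ∘ here ∘ just-injective)
    extend-along (_ ∷ b ∷ c ∷ P) walk (a∉ ∷ u , e ∷ l) ends d∉ =
      extend (extend-along (b ∷ c ∷ P) walk (u , l) ends (d∉ ∘ there)) (E-sym e)
             (All.lookup a∉ (there (here refl)) ∘ sym ∘ just-injective)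

module RankOneEdges {n : ℕ} (G : Graph n) (forest : IsForest G)
  {ℓ : ℕ} (p : Fin n → Maybe (Fin ℓ)) (partition : IsCatPartition G ℓ p)
  (ord : Fin ℓ → List (Fin n))
  (ord⊆branch : ∀ {i v} → v ∈ ord i → IsBranch G p i v)
  (branch⊆ord : ∀ {i v} → IsBranch G p i v → v ∈ ord i) where
  open Graph G

  RankOneCrossingEdge : Set
  RankOneCrossingEdge = ∃[ i ] ∃[ j ] ∃[ x ] ∃[ y ]
    (i ≢ j × p x ≡ just i × p y ≡ just j × E x y × HasRank1 G (ord i) x × HasRank1 G (ord j) y)

  cover : ∀ v → NonIsolated G v → ∃[ i ] p v ≡ just i
  cover = proj₁ partition

  caterpillar : ∀ i → IsCaterpillar G (Part G p i)
  caterpillar = proj₁ (proj₂ (proj₂ partition))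

  same-part : ∀ {x i j} → p x ≡ just i → p x ≡ just j → i ≡ j
  same-part px px′ = just-injective (trans (sym px) px′)

  different-parts : ∀ {x y i j} → p x ≡ just i → p y ≡ just j → i ≢ j → x ≢ y
  different-parts px py i≢j refl = i≢j (same-part px py)

  rank-one-exists : ∀ {i v} → IsBranch G p i v → ∃[ x ] HasRank1 G (ord i) x
  rank-one-exists br = nonempty (branch⊆ord br)

  rank-one-is-branch : ∀ {i x} → HasRank1 G (ord i) x → IsBranch G p i x
  rank-one-is-branch (_ , eq) = ord⊆branch (subst (_ ∈_) (sym eq) (here refl))

  branchless-part-is-component : ∀ {i v} → (∀ {w} → ¬ IsBranch G p i w) → p v ≡ just i →
                                 Part G p i ≐ Component G v
  branchless-part-is-component {i} no-branch pv =
    component-of-closed G (caterpillar-connected G (caterpillar i)) closed pv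
    where
    closed : ∀ {a b} → p a ≡ just i → E a b → p b ≡ just i
    closed {a} {b} pa e with cover b (a , E-sym e)
    ... | j , pb with i ≟ j
    ...   | yes refl = pb
    ...   | no i≢j = ⊥-elim (no-branch (pa , b , j , e , pb , i≢j))

  -- Walks are stored newest vertex first: the last edge xy leaves the rank-1 vertex x of C_i.
  data CrossingPath : List (Fin n) → Set where
    crossing : ∀ {i j x y W} → i ≢ j → p x ≡ just i → p y ≡ just j → E x y →
               HasRank1 G (ord i) x → SimplePath G (y ∷ x ∷ W) → CrossingPath (y ∷ x ∷ W)

  crossing-unique : ∀ {W} → CrossingPath W → Unique W
  crossing-unique (crossing _ _ _ _ _ (u , _)) = u

  crossing-from : ∀ {i x} → HasRank1 G (ord i) x → ∃[ W ] CrossingPath W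
  crossing-from rank1 with rank-one-is-branch rank1
  ... | px , u , _ , exu , pu , i≢j =
    u ∷ _ ∷ [] , crossing i≢j px pu exu rank1 (((λ { refl → E-irrefl exu }) ∷ []) ∷ [] ∷ [] , E-sym exu ∷ [-])

  crossing-step : ∀ {W} → CrossingPath W →
                  RankOneCrossingEdge ⊎ ∃[ W′ ] (CrossingPath W′ × length W < length W′)
  crossing-step (crossing {i} {j} {x} {y} {W} i≢j px py exy rank1-x walk)
    with rank-one-exists (py , x , i , E-sym exy , px , i≢j ∘ sym)
  ... | x′ , rank1-x′ with rank-one-is-branch rank1-x′
  ... | px′ , u , _ , ex′u , pu , j≢j′ with caterpillar-connected G (caterpillar j) x′ y px′ py
  ... | _ , _ , ([] , refl) , refl = inj₁ (i , j , x , y , i≢j , px , py , exy , rank1-x , rank1-x′)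
  ... | _ , (_ , uniq , inC , l) , (s ∷ Q , refl) , ends =
    inj₂ (u ∷ x′ ∷ s ∷ (Q ++ x ∷ W) , crossing j≢j′ px′ pu ex′u rank1-x′ walk′ ,
          s≤s (s≤s (s≤s (≤-trans (n≤1+n _) (length-++-≤ʳ (x ∷ W) {Q})))))
    where
    x∉ : x ∉ x′ ∷ s ∷ Q
    x∉ x∈ = i≢j (same-part px (All.lookup inC x∈))
    walk′ : SimplePath G (u ∷ x′ ∷ s ∷ (Q ++ x ∷ W))
    walk′ = extend G forest (extend-along G forest (x′ ∷ s ∷ Q) walk (uniq , l) ends x∉) ex′u
                   (different-parts (All.lookup inC (there (here refl))) pu j≢j′ ∘ just-injective)

  rank-one-crossing-edge : ∀ {i x} → HasRank1 G (ord i) x → RankOneCrossingEdge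
  rank-one-crossing-edge rank1 =
    unique-extension-terminates CrossingPath crossing-unique crossing-step (proj₂ (crossing-from rank1))

  from-non-caterpillar : ∀ {v} → NonIsolated G v → ¬ IsCaterpillar G (Component G v) →
                         RankOneCrossingEdge
  from-non-caterpillar {v} non-isolated ¬caterpillar with cover v non-isolated
  ... | i , pv with ord i in eq
  ...   | x ∷ rest = rank-one-crossing-edge (rest , eq)
  ...   | [] = ⊥-elim (¬caterpillar (IsCaterpillar-resp G (branchless-part-is-component no-branch pv) (caterpillar i)))
    where
    no-branch : ∀ {w} → ¬ IsBranch G p i w
    no-branch br = ∉[] (subst (_ ∈_) eq (branch⊆ord br))

lemma3p4 : (n : ℕ) (G : Graph n) → IsForest G →
    (ℓ : ℕ) (p : Fin n → Maybe (Fin ℓ)) → IsMinCatPartition G ℓ p →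
    (L ord : Fin ℓ → List (Fin n)) → (∀ i → IsRanking G p i (L i) (ord i)) →
    (∃[ v ] ¬ IsCaterpillar G (Component G v)) →
    ∃[ i ] ∃[ j ] ∃[ x ] ∃[ y ]
    (i ≢ j × p x ≡ just i × p y ≡ just j × Graph.E G x y ×
    HasRank1 G (ord i) x × HasRank1 G (ord j) y)
lemma3p4 n G forest ℓ p (partition , _) L ord ranked (v , ¬caterpillar) with any? (Graph.E-dec G v)
... | no isolated = ⊥-elim (¬caterpillar (isolated-component-caterpillar G isolated))
... | yes non-isolated =
  RankOneEdges.from-non-caterpillar G forest p partition ord ord⊆branch branch⊆ord non-isolated ¬caterpillar
  where
  ord⊆branch : ∀ {i v} → v ∈ ord i → IsBranch G p i v
  ord⊆branch {i} {v} = proj₁ (proj₂ (proj₂ (ranked i))) v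
  branch⊆ord : ∀ {i v} → IsBranch G p i v → v ∈ ord i
  branch⊆ord {i} {v} = proj₁ (proj₂ (proj₂ (proj₂ (ranked i)))) v
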